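{- Let $H=(\mathcal{V},\mathcal{E})$ be an interval hypergraph and let $\{\mathcal{E}_1,\dots,\mathcal{E}_k\}$ be a partition of $\mathcal{E}$ such that each $H_i=(\mathcal{V},\mathcal{E}_i)$ has an exact hitting set $h_i$. Define $t:\mathcal{E}\to\mathcal{V}$ by letting $t(I)$, for $I\in\mathcal{E}_i$, be the unique vertex of $I\cap h_i$. Then the clique number of the co-occurrence graph $\Gamma_t$ is at most $k$.
   Context: An interval hypergraph has vertex set $[n]=\{1,\dots,n\}$ and hyperedges that are intervals $\{i,\dots,j\}\subseteq[n]$. An exact hitting set of $(\mathcal{V},\mathcal{F})$ is $T\subseteq\mathcal{V}$ with $|T\cap e|=1$ for all $e\in\mathcal{F}$. For $t:\mathcal{E}\to\mathcal{V}$ with $t(e)\in e$ and image $R$, the co-occurrence graph $\Gamma_t$ has vertex set $R$, with distinct $u,v$ adjacent iff some $e\in\mathcal{E}$ satisfies $u,v\in e$ and $t(e)\in\{u,v\}$. -}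

module Defs where

open import Data.Nat using (ℕ; _≤_)
open import Data.Fin using (Fin)
open import Data.Product using (Σ; ∃; _×_; _,_)
open import Data.Sum using (_⊎_)
open import Data.List using (List)
open import Data.List.Relation.Unary.All using (All)
open import Data.List.Relation.Unary.AllPairs using (AllPairs)
open import Relation.Binary.PropositionalEquality using (_≡_; _≢_)
open import Function.Definitions using (Injective; Surjective)

record Interval : Set where
  constructor [_⋯_]
  field
    lo hi : ℕ
open Interval public

_∈ᴵ_ : ℕ → Interval → Set
v ∈ᴵ I = lo I ≤ v × v ≤ hi I

IntervalIn : ℕ → Interval → Set
IntervalIn n I = 1 ≤ lo I × lo I ≤ hi I × hi I ≤ n

IsIntervalHypergraph : (n m : ℕ) → (Fin m → Interval) → Set
IsIntervalHypergraph n m E = (∀ e → IntervalIn n (E e)) × Injective _≡_ _≡_ E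

IsExactHittingSet : (n : ℕ) → (F : Interval → Set) → (T : ℕ → Set) → Set
IsExactHittingSet n F T =
  (∀ v → T v → 1 ≤ v × v ≤ n) ×
  (∀ I → F I → Σ ℕ λ v → (v ∈ᴵ I × T v) × (∀ w → w ∈ᴵ I → T w → w ≡ v))

Block : ∀ {m k} → (Fin m → Interval) → (Fin m → Fin k) → Fin k → Interval → Set
Block E c i I = ∃ λ e → c e ≡ i × E e ≡ I

-- c : Fin m → Fin k encodes a partition {E_1,...,E_k} of the edge set into
-- k (nonempty) blocks: every edge lies in exactly one block, blocks nonempty.
IsPartition : ∀ {m k} → (Fin m → Fin k) → Set
IsPartition {m} {k} c = Surjective _≡_ _≡_ c

InImage : ∀ {m} → (Fin m → ℕ) → ℕ → Set
InImage t u = ∃ λ e → t e ≡ u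

CoAdj : ∀ {m} → (Fin m → Interval) → (Fin m → ℕ) → ℕ → ℕ → Set
CoAdj E t u v = u ≢ v × ∃ λ e → u ∈ᴵ E e × v ∈ᴵ E e × (t e ≡ u ⊎ t e ≡ v)

IsClique : ∀ {m} → (Fin m → Interval) → (Fin m → ℕ) → List ℕ → Set
IsClique E t C = All (InImage t) C × AllPairs (CoAdj E t) C

module Submission where

-- Every clique C of the co-occurrence graph Γ_t is shown to be
-- matched by at least |C| pairwise distinct colours i ∈ Fin k; hence |C| ≤ k.
-- The colours are collected by induction on the width of a window
-- W = [a ⋯ a + d] containing C, keeping the invariant that every collected
-- colour i has a vertex of h_i inside W (a "palette" for C in W).
--   * If an endpoint of W is not in C, shrink W by that endpoint.
--   * If both endpoints a < b lie in C, they are adjacent in Γ_t: some edge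
--     e contains a and b, so e ⊇ W, and t(e) ∈ {a, b}.  Remove the endpoint
--     t(e) from C and from W and recurse.  The colour c(e) is new: h_{c(e)}
--     meets e ⊇ W only in t(e), which lies outside the shrunken window,
--     while every previously collected colour meets the shrunken window.

open import Defs
open import Data.Nat using (ℕ; zero; suc; _+_; _≤_; z≤n; s≤s; _≟_)
open import Data.Nat.Properties
  using (≤-refl; ≤-trans; ≤-reflexive; ≤-antisym; ≤-pred; ≤∧≢⇒<; +-suc; +-identityʳ; n≤1+n; n≮n; m≤m+n)
open import Data.Fin using (Fin; zero; suc)
open import Data.Fin.Properties using (injective⇒≤)
open import Data.List using (List; []; _∷_; length; filter; lookup)
open import Data.List.Properties using (filter-all)
open import Data.List.Relation.Unary.All as All using (All; []; _∷_)
open import Data.List.Relation.Unary.All.Properties using (all-filter; filter⁺; ¬Any⇒All¬)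
open import Data.List.Relation.Unary.AllPairs as AllPairs using ([]; _∷_)
import Data.List.Relation.Unary.AllPairs.Properties as AllPairsₚ
open import Data.List.Relation.Unary.Unique.Propositional using (Unique)
open import Data.List.Membership.Propositional using (_∈_)
open import Data.List.Membership.Propositional.Properties using (∈-lookup; ∈-AllPairs₂)
open import Data.List.Membership.DecPropositional _≟_ using (_∈?_)
open import Data.Product using (∃; _×_; _,_; proj₁; proj₂)
open import Data.Sum using (_⊎_; inj₁; inj₂; swap)
open import Relation.Nullary using (¬_; yes; no; ¬?; contradiction)
open import Relation.Binary.Definitions using (DecidableEquality)
open import Relation.Binary.PropositionalEquality using (_≡_; _≢_; refl; sym; trans; subst; cong)

lookup-injective : ∀ {A : Set} {xs : List A} → Unique xs →
                   ∀ {i j} → lookup xs i ≡ lookup xs j → i ≡ j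
lookup-injective (_   ∷ _)  {zero}  {zero}  _  = refl
lookup-injective (x∉ ∷ _)  {zero}  {suc j} eq = contradiction eq (All.lookup x∉ (∈-lookup j))
lookup-injective (x∉ ∷ _)  {suc i} {zero}  eq = contradiction (sym eq) (All.lookup x∉ (∈-lookup i))
lookup-injective (_   ∷ u)  {suc i} {suc j} eq = cong suc (lookup-injective u eq)

unique-length≤ : ∀ {k} {L : List (Fin k)} → Unique L → length L ≤ k
unique-length≤ u = injective⇒≤ (lookup-injective u)

length-delete : ∀ {A : Set} (_≟ᴬ_ : DecidableEquality A) v {xs : List A} → Unique xs →
                length xs ≤ suc (length (filter (λ x → ¬? (v ≟ᴬ x)) xs))
length-delete _≟ᴬ_ v []              = z≤n
length-delete _≟ᴬ_ v {x ∷ xs} (x∉ ∷ u) with v ≟ᴬ x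
... | yes refl = s≤s (≤-reflexive (cong length (sym (filter-all (λ y → ¬? (x ≟ᴬ y)) x∉))))
... | no  _    = s≤s (length-delete _≟ᴬ_ v u)

_⊆ᴵ_ : Interval → Interval → Set
W ⊆ᴵ I = ∀ {v} → v ∈ᴵ W → v ∈ᴵ I

⊆ᴵ-convex : ∀ {W I} → lo W ∈ᴵ I → hi W ∈ᴵ I → W ⊆ᴵ I
⊆ᴵ-convex (lo-I≤ , _) (_ , ≤hi-I) (lo-W≤v , v≤hi-W) = ≤-trans lo-I≤ lo-W≤v , ≤-trans v≤hi-W ≤hi-I

window : ℕ → ℕ → Interval
window a d = [ a ⋯ a + d ]

module Window (a d : ℕ) where
  W upper lower : Interval
  W     = window a (suc d)
  upper = window (suc a) d
  lower = window a d

  lo∈W : a ∈ᴵ W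
  lo∈W = ≤-refl , m≤m+n a (suc d)

  hi∈W : (a + suc d) ∈ᴵ W
  hi∈W = m≤m+n a (suc d) , ≤-refl

  upper⊆W : upper ⊆ᴵ W
  upper⊆W (a<v , v≤) = ≤-trans (n≤1+n a) a<v , ≤-trans v≤ (≤-reflexive (sym (+-suc a d)))

  lower⊆W : lower ⊆ᴵ W
  lower⊆W (a≤v , v≤) = a≤v , ≤-trans v≤ (≤-trans (n≤1+n (a + d)) (≤-reflexive (sym (+-suc a d))))

  lo∉upper : ¬ (a ∈ᴵ upper)
  lo∉upper (a<a , _) = n≮n a a<a

  hi∉lower : ¬ ((a + suc d) ∈ᴵ lower)
  hi∉lower (_ , b≤) = n≮n (a + d) (≤-trans (≤-reflexive (sym (+-suc a d))) b≤)

  into-upper : ∀ {v} → v ∈ᴵ W → a ≢ v → v ∈ᴵ upper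
  into-upper (a≤v , v≤) a≢v = ≤∧≢⇒< a≤v a≢v , ≤-trans v≤ (≤-reflexive (+-suc a d))

  into-lower : ∀ {v} → v ∈ᴵ W → a + suc d ≢ v → v ∈ᴵ lower
  into-lower (a≤v , v≤) b≢v =
    a≤v , ≤-pred (≤-trans (≤∧≢⇒< v≤ (λ eq → b≢v (sym eq))) (≤-reflexive (+-suc a d)))

  lo≢hi : a ≢ a + suc d
  lo≢hi a≡b = hi∉lower (subst (_∈ᴵ lower) a≡b (≤-refl , m≤m+n a d))

joining-edge : ∀ {m} {E : Fin m → Interval} {t : Fin m → ℕ} {C u v} →
               IsClique E t C → u ∈ C → v ∈ C → u ≢ v →
               ∃ λ e → u ∈ᴵ E e × v ∈ᴵ E e × (t e ≡ u ⊎ t e ≡ v)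
joining-edge (_ , adj) u∈C v∈C u≢v with ∈-AllPairs₂ adj u∈C v∈C
... | inj₁ u≡v                            = contradiction u≡v u≢v
... | inj₂ (inj₁ (_ , e , u∈e , v∈e , t≡)) = e , u∈e , v∈e , t≡
... | inj₂ (inj₂ (_ , e , v∈e , u∈e , t≡)) = e , u∈e , v∈e , swap t≡

delete : ℕ → List ℕ → List ℕ
delete v = filter (λ x → ¬? (v ≟ x))

clique-delete : ∀ {m} {E : Fin m → Interval} {t : Fin m → ℕ} {C} v →
                IsClique E t C → IsClique E t (delete v C)
clique-delete v (img , adj) = filter⁺ _ img , AllPairsₚ.filter⁺ _ adj

clique-unique : ∀ {m} {E : Fin m → Interval} {t : Fin m → ℕ} {C} → IsClique E t C → Unique C
clique-unique (_ , adj) = AllPairs.map proj₁ adj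

module Palettes {n m k : ℕ} (E : Fin m → Interval) (c : Fin m → Fin k) (h : Fin k → ℕ → Set)
  (exact : ∀ i → IsExactHittingSet n (Block E c i) (h i))
  (t : Fin m → ℕ) (t∈E : ∀ e → t e ∈ᴵ E e) (t∈h : ∀ e → h (c e) (t e)) where

  only-t : ∀ e {w} → w ∈ᴵ E e → h (c e) w → w ≡ t e
  only-t e w∈e w∈h with proj₂ (exact (c e)) (E e) (e , refl , refl)
  ... | _ , _ , unique = trans (unique _ w∈e w∈h) (sym (unique _ (t∈E e) (t∈h e)))

  Visible : Interval → Fin k → Set
  Visible W i = ∃ λ w → h i w × w ∈ᴵ W

  visible-widen : ∀ {W W' i} → W' ⊆ᴵ W → Visible W' i → Visible W i
  visible-widen W'⊆W (w , w∈h , w∈W') = w , w∈h , W'⊆W w∈W'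

  record Palette (W : Interval) (C : List ℕ) : Set where
    constructor mkPalette
    field
      colours  : List (Fin k)
      distinct : Unique colours
      long     : length C ≤ length colours
      visible  : All (Visible W) colours

  widen : ∀ {W W' C} → W' ⊆ᴵ W → Palette W' C → Palette W C
  widen W'⊆W (mkPalette L distinct long visible) =
    mkPalette L distinct long (All.map (visible-widen W'⊆W) visible)

  -- The key step: if the edge e covers W and t e is in W but outside the
  -- subwindow W', then the colour c e is visible in W and invisible in W',
  -- so it extends a palette in W' by one colour.
  extend : ∀ e {v W W' C C'} → t e ≡ v → W ⊆ᴵ E e → W' ⊆ᴵ W → v ∈ᴵ W → ¬ (v ∈ᴵ W') →
           length C ≤ suc (length C') → Palette W' C' → Palette W C
  extend e {W' = W'} refl W⊆e W'⊆W te∈W te∉W' shorter (mkPalette L distinct long visible) =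
    mkPalette (c e ∷ L) (All.map new visible ∷ distinct) (≤-trans shorter (s≤s long))
              ((t e , t∈h e , te∈W) ∷ All.map (visible-widen W'⊆W) visible)
    where
    new : ∀ {i} → Visible W' i → c e ≢ i
    new (w , w∈h , w∈W') refl = te∉W' (subst (_∈ᴵ W') (only-t e (W⊆e (W'⊆W w∈W')) w∈h) w∈W')

  palette-point : ∀ a {C} → IsClique E t C → All (_∈ᴵ window a 0) C → Palette (window a 0) C
  palette-point a {[]}         _                       _                     = mkPalette [] [] z≤n []
  palette-point a {x ∷ []}     ((e , te≡x) ∷ [] , _)   (x∈W ∷ [])            =
    mkPalette (c e ∷ []) ([] ∷ []) ≤-refl ((x , subst (h (c e)) te≡x (t∈h e) , x∈W) ∷ [])
  palette-point a {x ∷ y ∷ _}  (_ , (x~y ∷ _) AllPairs.∷ _) (x∈W ∷ y∈W ∷ _) =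
    contradiction (trans (is-a x∈W) (sym (is-a y∈W))) (proj₁ x~y)
    where
    is-a : ∀ {v} → v ∈ᴵ window a 0 → v ≡ a
    is-a (a≤v , v≤a) = ≤-antisym (≤-trans v≤a (≤-reflexive (+-identityʳ a))) a≤v

  restrict : ∀ {v W W' C} → (∀ {x} → x ∈ᴵ W → v ≢ x → x ∈ᴵ W') →
             All (_∈ᴵ W) C → All (v ≢_) C → All (_∈ᴵ W') C
  restrict into C⊆W v∉C = All.zipWith (λ (x∈W , v≢x) → into x∈W v≢x) (C⊆W , v∉C)

  module _ (a d : ℕ) where
    open Window a d

    palette-step : (∀ {C} → IsClique E t C → All (_∈ᴵ upper) C → Palette upper C) →
                   (∀ {C} → IsClique E t C → All (_∈ᴵ lower) C → Palette lower C) →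
                   ∀ {C} → IsClique E t C → All (_∈ᴵ W) C → Palette W C
    palette-step in-upper in-lower {C} K C⊆W with a ∈? C | (a + suc d) ∈? C
    ... | no a∉C | _      =
      widen upper⊆W (in-upper K (restrict into-upper C⊆W (¬Any⇒All¬ C a∉C)))
    ... | yes _  | no b∉C =
      widen lower⊆W (in-lower K (restrict into-lower C⊆W (¬Any⇒All¬ C b∉C)))
    ... | yes a∈C | yes b∈C with joining-edge K a∈C b∈C lo≢hi
    ...   | e , a∈e , b∈e , inj₁ te≡a =
      extend e te≡a (⊆ᴵ-convex a∈e b∈e) upper⊆W lo∈W lo∉upper
        (length-delete _≟_ a (clique-unique K))
        (in-upper (clique-delete a K) (restrict into-upper (filter⁺ _ C⊆W) (all-filter _ C)))
    ...   | e , a∈e , b∈e , inj₂ te≡b =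
      extend e te≡b (⊆ᴵ-convex a∈e b∈e) lower⊆W hi∈W hi∉lower
        (length-delete _≟_ (a + suc d) (clique-unique K))
        (in-lower (clique-delete (a + suc d) K) (restrict into-lower (filter⁺ _ C⊆W) (all-filter _ C)))

  palette : ∀ d a {C} → IsClique E t C → All (_∈ᴵ window a d) C → Palette (window a d) C
  palette zero    a = palette-point a
  palette (suc d) a = palette-step a d (palette d (suc a)) (palette d a)

lemma13 : (n m k : ℕ) (E : Fin m → Interval) → IsIntervalHypergraph n m E →
          (c : Fin m → Fin k) → IsPartition c →
          (h : Fin k → ℕ → Set) →
          (∀ i → IsExactHittingSet n (Block E c i) (h i)) →
          (t : Fin m → ℕ) →
          (∀ e → t e ∈ᴵ E e) → (∀ e → h (c e) (t e)) →
          (C : List ℕ) → IsClique E t C → length C ≤ k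
lemma13 n _ _ E (E⊆[n] , _) c _ h exact t t∈E t∈h _ K@(image , _) =
  ≤-trans long (unique-length≤ distinct)
  where
  open Palettes E c h exact t t∈E t∈h

  in-window : ∀ {x} → InImage t x → x ∈ᴵ window 0 n
  in-window (e , refl) = z≤n , ≤-trans (proj₂ (t∈E e)) (proj₂ (proj₂ (E⊆[n] e)))

  open Palette (palette n 0 K (All.map in-window image))
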